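{- Let $X$ be a finite set with $|X|\ge 2$, let $\mathcal N$ be a temporal tree-child network on $X$, and suppose $\mathcal N$ rigidly displays two phylogenetic trees $\mathcal T$ and $\mathcal T'$ on $X$ via display maps $\psi$ and $\psi'$. Then $2\le \gamma_\psi(v)+\gamma_{\psi'}(v)\le 3$ for all $v\in V(\mathcal N)\setminus\{\rho_{\mathcal N}\}$.
   Context: A phylogenetic network on $X$ is a rooted directed acyclic graph without parallel edges whose leaves (vertices of indegree 1 and outdegree 0) are exactly the elements of $X$, whose root $\rho_{\mathcal N}$ has indegree 0 and outdegree 2, and in which every other non-leaf vertex either has indegree 1 and outdegree 2, or indegree 2 and outdegree 1 (a reticulation vertex). Vertices of indegree 1 and outdegree 2 or 0 are tree vertices. A phylogenetic tree is a phylogenetic network with no reticulation vertices. $\mathcal N$ is temporal if there is $t:V(\mathcal N)\to\mathbb R_{\ge0}$ with $t(p)=t(q)$ for every edge $(p,q)$ with $q$ a reticulation vertex and $t(p)<t(q)$ for all other edges. $\mathcal N$ is tree-child if every non-leaf vertex has a child that is a tree vertex. A display map for a tree $\mathcal T$ in $\mathcal N$ is a map $\psi:V(\mathcal T)\to V(\mathcal N)$, identity on $X$, together with for each edge $e$ of $\mathcal T$ a directed path $\psi[e]$ with at least one edge from $\psi(tail(e))$ to $\psi(head(e))$, such that every $\psi(v)$ is a tree vertex or the root, and for distinct edges $e,e'$ with the same tail the first edges of $\psi[e],\psi[e']$ differ. $\gamma_\psi(w)$ is the number of edges $e=(u,v)$ of $\mathcal T$ with $w$ on $\psi[e]$ and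 $w\ne\psi(u)$. $\mathcal N$ rigidly displays $\mathcal T$ and $\mathcal T'$ via display maps $\psi,\psi'$ (for $\mathcal T,\mathcal T'$ respectively) if, writing $\gamma=\gamma_\psi+\gamma_{\psi'}$, every reticulation vertex $v$ satisfies $\gamma(v)\le 3$ and every parent $w$ of a reticulation vertex satisfies $\gamma(w)\le 2$.
   Formalization: The temporal labelling $t$ takes values in the nonnegative rationals rather than in $\mathbb R_{\ge0}$. -}

module Defs where

open import Data.Nat using (ℕ; zero; suc; _+_; _≤_)
open import Data.Fin using (Fin; zero; suc; _≟_)
open import Data.Bool using (Bool; true; false; T; _∧_; not)
open import Data.Unit using (tt)
open import Data.Product using (Σ; ∃; _×_; _,_)
open import Data.Sum using (_⊎_)
open import Data.List using (List; []; _∷_)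
open import Relation.Nullary using (¬_; does)
open import Relation.Binary.PropositionalEquality using (_≡_; _≢_)
open import Data.Rational using (ℚ; 0ℚ) renaming (_≤_ to _≤ℚ_; _<_ to _<ℚ_)
open import Function.Definitions using (Injective)

sumF : ∀ {k} → (Fin k → ℕ) → ℕ
sumF {zero} f = 0
sumF {suc k} f = f zero + sumF (λ i → f (suc i))

b2n : Bool → ℕ
b2n true = 1
b2n false = 0

record Digraph : Set where
  field
    size : ℕ
    edge : Fin size → Fin size → Bool

module _ (G : Digraph) where
  open Digraph G

  V : Set
  V = Fin size

  E : V → V → Set
  E u v = T (edge u v)

  indeg : V → ℕ
  indeg v = sumF (λ u → b2n (edge u v))

  outdeg : V → ℕ
  outdeg u = sumF (λ v → b2n (edge u v))

  IsTreeVertex : V → Set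
  IsTreeVertex v = indeg v ≡ 1 × (outdeg v ≡ 2 ⊎ outdeg v ≡ 0)

  IsReticulation : V → Set
  IsReticulation v = indeg v ≡ 2 × outdeg v ≡ 1

  IsLeaf : V → Set
  IsLeaf v = indeg v ≡ 1 × outdeg v ≡ 0

  -- directed path with at least one edge
  data Walk : V → V → Set where
    one : ∀ {u v} → E u v → Walk u v
    step : ∀ {u w v} → E u w → Walk w v → Walk u v

  after : ∀ {u v} → Walk u v → List V
  after (one {v = v} _) = v ∷ []
  after (step {w = w} _ p) = w ∷ after p

  verts : ∀ {u v} → Walk u v → List V
  verts {u} p = u ∷ after p

  second : ∀ {u v} → Walk u v → V
  second (one {v = v} _) = v
  second (step {w = w} _ _) = w

  Acyclic : Set
  Acyclic = ∀ v → ¬ Walk v v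

-- phylogenetic network on X = Fin m
record PhyloNetwork (m : ℕ) : Set where
  field
    graph : Digraph
    root : V graph
    leaf : Fin m → V graph
    acyclic : Acyclic graph
    root-deg : indeg graph root ≡ 0 × outdeg graph root ≡ 2
    other-deg : ∀ v → v ≢ root →
      (indeg graph v ≡ 1 × outdeg graph v ≡ 2)
      ⊎ (indeg graph v ≡ 2 × outdeg graph v ≡ 1)
      ⊎ (indeg graph v ≡ 1 × outdeg graph v ≡ 0)
    leaf-inj : Injective _≡_ _≡_ leaf
    leaf-isLeaf : ∀ x → IsLeaf graph (leaf x)
    leaf-onto : ∀ v → IsLeaf graph v → ∃ λ x → leaf x ≡ v

open PhyloNetwork public

record PhyloTree (m : ℕ) : Set where
  field
    net : PhyloNetwork m
    noRet : ∀ v → ¬ IsReticulation (graph net) v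

open PhyloTree public

IsTemporal : ∀ {m} → PhyloNetwork m → Set
IsTemporal N = Σ (V G → ℚ) λ t →
  (∀ v → 0ℚ ≤ℚ t v) ×
  (∀ p q → E G p q →
     (IsReticulation G q → t p ≡ t q) × (¬ IsReticulation G q → t p <ℚ t q))
  where G = graph N

IsTreeChild : ∀ {m} → PhyloNetwork m → Set
IsTreeChild N = ∀ v → ¬ IsLeaf G v → ∃ λ c → E G v c × IsTreeVertex G c
  where G = graph N

record DisplayMap {m} (Tr : PhyloTree m) (N : PhyloNetwork m) : Set where
  private
    GT = graph (net Tr)
    GN = graph N
  field
    ψ : V GT → V GN
    path : ∀ u v → E GT u v → Walk GN (ψ u) (ψ v)
    id-on-X : ∀ x → ψ (leaf (net Tr) x) ≡ leaf N x
    tree-or-root : ∀ v → IsTreeVertex GN (ψ v) ⊎ ψ v ≡ root N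
    first-distinct : ∀ u v v' (e : E GT u v) (e' : E GT u v') → v ≢ v' →
      second GN (path u v e) ≢ second GN (path u v' e')

open DisplayMap public

indic : (b : Bool) → (T b → ℕ) → ℕ
indic true f = f tt
indic false f = 0

gamma : ∀ {m} {Tr : PhyloTree m} {N : PhyloNetwork m} →
  DisplayMap Tr N → V (graph N) → ℕ
gamma {Tr = Tr} {N} D w =
  sumF λ u → sumF λ v → indic (Digraph.edge (graph (net Tr)) u v) λ e →
    b2n (does (Data.List.Membership.DecPropositional._∈?_ _≟_ w
                 (verts (graph N) (path D u v e)))
         ∧ not (does (w ≟ ψ D u)))
  where import Data.List.Membership.DecPropositional

RigidlyDisplays : ∀ {m} {Tr Tr' : PhyloTree m} (N : PhyloNetwork m) →
  DisplayMap Tr N → DisplayMap Tr' N → Set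
RigidlyDisplays N D D' =
  (∀ v → IsReticulation G v → γ v ≤ 3) ×
  (∀ w v → E G w v → IsReticulation G v → γ w ≤ 2)
  where
    G = graph N
    γ : V G → ℕ
    γ x = gamma D x + gamma D' x

module Submission where

-- Both display maps send the root of their tree to the root ρ of N: the
-- children of ρ are tree vertices (a reticulation child of ρ would have a second parent with
-- the same time as ρ, which neither a tree vertex nor, by tree-child, a reticulation can be),
-- and tree paths from the two children down to the image of the tree root would have to meet.
-- Going down from v ≠ ρ along tree children one meets a leaf or a vertex on an image path;
-- since each step enters a vertex with a unique parent, γ ≥ 1 propagates back up to v,
-- unless at some step the image path starts at the image of the tree root, which is ρ.
-- Upwards, a vertex w whose only parent is p is passed by an image path only right after p,
-- so γ(w) ≤ γ(p): the paths that start at p towards w are, by distinct first edges, no more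
-- than the tree vertices mapped to p, hence (for p ≠ ρ) no more than the paths ending at p.
-- For p = ρ this gives γ(w) ≤ 1, so the sum can exceed 2 only at reticulations, where
-- rigidity bounds it by 3.

open import Defs
open import Data.Bool using (true; false; T; _∧_; not)
open import Data.Empty using (⊥-elim)
open import Data.Fin using (Fin; zero; suc; _≟_)
open import Data.Fin.Properties using (suc-injective; injective⇒≤) renaming (0≢1+n to zero≢suc)
open import Data.List using (List; []; _∷_)
open import Data.List.Membership.Propositional using (_∈_)
import Data.List.Membership.DecPropositional as DecMembership
open import Data.List.Relation.Unary.Any using (here; there)
import Data.Nat as ℕ
open import Data.Nat using (ℕ; zero; suc; _+_; _≤_; _<_; z≤n; s≤s)
open import Data.Nat.Properties hiding (_≟_; suc-injective)
open import Algebra.Properties.CommutativeSemigroup +-commutativeSemigroup using (interchange)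
open import Data.Product using (Σ; ∃; ∃₂; _×_; _,_; proj₁; proj₂)
open import Data.Rational using (ℚ) renaming (_≤_ to _≤ℚ_; _<_ to _<ℚ_)
import Data.Rational.Properties as ℚ
open import Data.Sum using (_⊎_; inj₁; inj₂)
open import Data.Unit using (tt)
open import Data.Vec using (Vec; []; _∷_; lookup)
open import Data.Vec.Relation.Unary.All using (All; []; _∷_) renaming (map to All-map)
open import Data.Vec.Relation.Unary.AllPairs using (AllPairs; []; _∷_)
open import Data.Vec.Relation.Unary.Unique.Propositional.Properties using (lookup-injective)
open import Function using (_∘_)
open import Relation.Nullary using (¬_; Dec; yes; no; does)
open import Relation.Nullary.Decidable using (_×-dec_; dec-true; dec-false)
open import Relation.Binary.PropositionalEquality

private variable
  k : ℕ

χ : {A : Set} → Dec A → ℕ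
χ d = b2n (does d)

b2n≤1 : ∀ b → b2n b ≤ 1
b2n≤1 true = s≤s z≤n
b2n≤1 false = z≤n

1≤b2n⇒T : ∀ {b} → 1 ≤ b2n b → T b
1≤b2n⇒T {true} _ = tt

T⇒1≤b2n : ∀ {b} → T b → 1 ≤ b2n b
T⇒1≤b2n {true} _ = s≤s z≤n

χ-yes : {A : Set} (d : Dec A) → A → χ d ≡ 1
χ-yes d a = cong b2n (dec-true d a)

χ-no : {A : Set} (d : Dec A) → ¬ A → χ d ≡ 0
χ-no d ¬a = cong b2n (dec-false d ¬a)

1≤χ⇒ : {A : Set} (d : Dec A) → 1 ≤ χ d → A
1≤χ⇒ (yes a) _ = a

sumF-cong : {f g : Fin k → ℕ} → (∀ i → f i ≡ g i) → sumF f ≡ sumF g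
sumF-cong {zero} _ = refl
sumF-cong {suc k} h = cong₂ _+_ (h zero) (sumF-cong (h ∘ suc))

sumF-mono : {f g : Fin k → ℕ} → (∀ i → f i ≤ g i) → sumF f ≤ sumF g
sumF-mono {zero} _ = z≤n
sumF-mono {suc k} h = +-mono-≤ (h zero) (sumF-mono (h ∘ suc))

sumF-0 : sumF {k} (λ _ → 0) ≡ 0
sumF-0 {zero} = refl
sumF-0 {suc k} = sumF-0 {k}

sumF-zero : {f : Fin k → ℕ} → (∀ i → f i ≡ 0) → sumF f ≡ 0
sumF-zero {k} f≡0 = trans (sumF-cong f≡0) (sumF-0 {k})

sumF-+ : (f g : Fin k → ℕ) → sumF (λ i → f i + g i) ≡ sumF f + sumF g
sumF-+ {zero} f g = refl
sumF-+ {suc k} f g =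
  trans (cong (f zero + g zero +_) (sumF-+ (f ∘ suc) (g ∘ suc)))
        (interchange (f zero) (g zero) _ _)

sumF-swap : ∀ {l} (f : Fin k → Fin l → ℕ) →
  sumF (λ i → sumF (f i)) ≡ sumF (λ j → sumF (λ i → f i j))
sumF-swap {zero} {l} f = sym (sumF-0 {l})
sumF-swap {suc k} f =
  trans (cong (sumF (f zero) +_) (sumF-swap (f ∘ suc)))
        (sym (sumF-+ (f zero) (λ j → sumF (λ i → f (suc i) j))))

term≤sumF : (f : Fin k → ℕ) (i : Fin k) → f i ≤ sumF f
term≤sumF f zero = m≤m+n _ _
term≤sumF f (suc i) = ≤-trans (term≤sumF (f ∘ suc) i) (m≤n+m _ (f zero))

1≤sumF⇒∃ : (f : Fin k → ℕ) → 1 ≤ sumF f → ∃ λ i → 1 ≤ f i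
1≤sumF⇒∃ {suc k} f h with f zero in eq
... | suc _ = zero , subst (1 ≤_) (sym eq) (s≤s z≤n)
... | zero = let i , fi = 1≤sumF⇒∃ (f ∘ suc) h in suc i , fi

sumF≤1 : (f : Fin k → ℕ) → (∀ i → f i ≤ 1) →
  (∀ i j → 1 ≤ f i → 1 ≤ f j → i ≡ j) → sumF f ≤ 1
sumF≤1 {zero} f _ _ = z≤n
sumF≤1 {suc k} f f≤1 unique with f zero in eq
... | zero = sumF≤1 (f ∘ suc) (f≤1 ∘ suc) (λ i j p q → suc-injective (unique (suc i) (suc j) p q))
... | suc n = begin
    suc n + sumF (f ∘ suc)  ≡⟨ cong (suc n +_) (sumF-zero rest≡0) ⟩
    suc n + 0               ≡⟨ +-identityʳ _ ⟩
    suc n                   ≡⟨ sym eq ⟩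
    f zero                  ≤⟨ f≤1 zero ⟩
    1                       ∎
  where
  open ≤-Reasoning
  rest≡0 : ∀ i → f (suc i) ≡ 0
  rest≡0 i = n<1⇒n≡0 (≰⇒> λ p → zero≢suc (unique zero (suc i) (subst (1 ≤_) (sym eq) (s≤s z≤n)) p))

2≤sumF⇒∃₂ : (f : Fin k → ℕ) → (∀ i → f i ≤ 1) → 2 ≤ sumF f →
  ∃₂ λ i j → i ≢ j × 1 ≤ f i × 1 ≤ f j
2≤sumF⇒∃₂ {suc k} f f≤1 h with f zero in eq
... | zero = let i , j , i≢j , fi , fj = 2≤sumF⇒∃₂ (f ∘ suc) (f≤1 ∘ suc) h
             in suc i , suc j , i≢j ∘ suc-injective , fi , fj
... | suc n = let j , fj = 1≤sumF⇒∃ (f ∘ suc) (≤-pred (≤-trans h (+-monoˡ-≤ _ (subst (_≤ 1) eq (f≤1 zero)))))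
              in zero , suc j , zero≢suc , subst (1 ≤_) (sym eq) (s≤s z≤n) , fj

∃₂⇒2≤sumF : (f : Fin k → ℕ) (i j : Fin k) → i ≢ j → 1 ≤ f i → 1 ≤ f j → 2 ≤ sumF f
∃₂⇒2≤sumF f zero zero i≢j _ _ = ⊥-elim (i≢j refl)
∃₂⇒2≤sumF f zero (suc j) _ fi fj = +-mono-≤ fi (≤-trans fj (term≤sumF (f ∘ suc) j))
∃₂⇒2≤sumF f (suc i) zero _ fi fj = +-mono-≤ fj (≤-trans fi (term≤sumF (f ∘ suc) i))
∃₂⇒2≤sumF f (suc i) (suc j) i≢j fi fj =
  ≤-trans (∃₂⇒2≤sumF (f ∘ suc) i j (i≢j ∘ cong suc) fi fj) (m≤n+m _ (f zero))

indic-mono : ∀ b {f g : T b → ℕ} → (∀ e → f e ≤ g e) → indic b f ≤ indic b g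
indic-mono true h = h tt
indic-mono false _ = z≤n

indic-+ : ∀ b (f g : T b → ℕ) → indic b (λ e → f e + g e) ≡ indic b f + indic b g
indic-+ true f g = refl
indic-+ false f g = refl

indic≤ : ∀ b {f : T b → ℕ} {c} → (∀ e → f e ≤ c) → indic b f ≤ c
indic≤ true h = h tt
indic≤ false _ = z≤n

indic-at : ∀ {b} (f : T b → ℕ) (e : T b) → indic b f ≡ f e
indic-at {true} f tt = refl

1≤indic⇒ : ∀ b (f : T b → ℕ) → 1 ≤ indic b f → Σ (T b) λ e → 1 ≤ f e
1≤indic⇒ true f h = tt , h

module Digraphs (G : Digraph) where
  open Digraph G

  private variable
    a b c c′ p r s u v w x y : V G

  first-edge : (q : Walk G u v) → E G u (second G q)
  first-edge (one e) = e
  first-edge (step e _) = e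

  last-edge : Walk G u v → ∃ λ y → E G y v
  last-edge (one e) = _ , e
  last-edge (step _ q) = last-edge q

  _▷_ : Walk G u v → E G v w → Walk G u w
  one e ▷ e′ = step e (one e′)
  step e q ▷ e′ = step e (q ▷ e′)

  end∈after : (q : Walk G u v) → v ∈ after G q
  end∈after (one _) = here refl
  end∈after (step _ q) = there (end∈after q)

  ∈after⇒walk : (q : Walk G u v) → x ∈ after G q → Walk G u x
  ∈after⇒walk (one e) (here refl) = one e
  ∈after⇒walk (step e _) (here refl) = one e
  ∈after⇒walk (step e q) (there x∈) = step e (∈after⇒walk q x∈)

  ∈verts⇒walk-to-end : (q : Walk G u v) → x ∈ verts G q → x ≡ v ⊎ Walk G x v
  ∈verts⇒walk-to-end (one e) (here refl) = inj₂ (one e)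
  ∈verts⇒walk-to-end (one _) (there (here refl)) = inj₁ refl
  ∈verts⇒walk-to-end (step e q) (here refl) = inj₂ (step e q)
  ∈verts⇒walk-to-end (step _ q) (there x∈) = ∈verts⇒walk-to-end q x∈

  ∈after⇒predecessor : (q : Walk G u v) → x ∈ after G q →
    x ≡ second G q ⊎ ∃ λ y → y ∈ after G q × E G y x
  ∈after⇒predecessor (one _) (here refl) = inj₁ refl
  ∈after⇒predecessor (step _ _) (here refl) = inj₁ refl
  ∈after⇒predecessor (step _ q) (there x∈) with ∈after⇒predecessor q x∈
  ... | inj₁ refl = inj₂ (_ , here refl , first-edge q)
  ... | inj₂ (y , y∈ , e) = inj₂ (y , there y∈ , e)

  ∈after⇒parent : (q : Walk G u v) → x ∈ after G q → ∃ λ y → E G y x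
  ∈after⇒parent q x∈ with ∈after⇒predecessor q x∈
  ... | inj₁ refl = _ , first-edge q
  ... | inj₂ (y , _ , e) = y , e

  length : Walk G u v → ℕ
  length (one _) = 1
  length (step _ q) = suc (length q)

  length-▷ : (q : Walk G u v) (e : E G v w) → length (q ▷ e) ≡ suc (length q)
  length-▷ (one _) e = refl
  length-▷ (step _ q) e = cong suc (length-▷ q e)

  afterVec : (q : Walk G u v) → Vec (V G) (length q)
  afterVec (one {v = v} _) = v ∷ []
  afterVec (step {w = w} _ q) = w ∷ afterVec q

  prefixes : (q : Walk G u v) → All (Walk G u) (afterVec q)
  prefixes (one e) = one e ∷ []
  prefixes (step e q) = one e ∷ All-map (step e) (prefixes q)

  indeg≡0⇒¬edge : indeg G v ≡ 0 → ¬ E G u v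
  indeg≡0⇒¬edge {u = u} d e =
    1+n≰n (subst (1 ≤_) d (≤-trans (T⇒1≤b2n e) (term≤sumF (λ u → b2n (edge u _)) u)))

  1≤indeg⇒parent : 1 ≤ indeg G v → ∃ λ u → E G u v
  1≤indeg⇒parent d = let u , e = 1≤sumF⇒∃ _ d in u , 1≤b2n⇒T e

  indeg≡1⇒parent-unique : indeg G v ≡ 1 → E G a v → E G b v → a ≡ b
  indeg≡1⇒parent-unique {a = a} {b} d ea eb with a ≟ b
  ... | yes a≡b = a≡b
  ... | no a≢b = ⊥-elim (1+n≰n (subst (2 ≤_) d
          (∃₂⇒2≤sumF (λ u → b2n (edge u _)) a b a≢b (T⇒1≤b2n ea) (T⇒1≤b2n eb))))

  outdeg≡1⇒child-unique : outdeg G u ≡ 1 → E G u a → E G u b → a ≡ b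
  outdeg≡1⇒child-unique {a = a} {b} d ea eb with a ≟ b
  ... | yes a≡b = a≡b
  ... | no a≢b = ⊥-elim (1+n≰n (subst (2 ≤_) d
          (∃₂⇒2≤sumF (λ v → b2n (edge _ v)) a b a≢b (T⇒1≤b2n ea) (T⇒1≤b2n eb))))

  indeg≡2⇒parents : indeg G v ≡ 2 → ∃₂ λ a b → a ≢ b × E G a v × E G b v
  indeg≡2⇒parents d =
    let a , b , a≢b , ea , eb = 2≤sumF⇒∃₂ _ (λ _ → b2n≤1 _) (≤-reflexive (sym d))
    in a , b , a≢b , 1≤b2n⇒T ea , 1≤b2n⇒T eb

  outdeg≡2⇒children : outdeg G u ≡ 2 → ∃₂ λ a b → a ≢ b × E G u a × E G u b
  outdeg≡2⇒children d =
    let a , b , a≢b , ea , eb = 2≤sumF⇒∃₂ _ (λ _ → b2n≤1 _) (≤-reflexive (sym d))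
    in a , b , a≢b , 1≤b2n⇒T ea , 1≤b2n⇒T eb

  data TreePath : V G → V G → Set where
    ε : TreePath x x
    _◅_ : E G x c × indeg G c ≡ 1 → TreePath c r → TreePath x r

  tverts : TreePath x r → List (V G)
  tverts {x} ε = x ∷ []
  tverts {x} (_ ◅ t) = x ∷ tverts t

  start∈tverts : (t : TreePath x r) → x ∈ tverts t
  start∈tverts ε = here refl
  start∈tverts (_ ◅ _) = here refl

  end∈tverts : (t : TreePath x r) → r ∈ tverts t
  end∈tverts ε = here refl
  end∈tverts (_ ◅ t) = there (end∈tverts t)

  ∈tverts⇒predecessor : (t : TreePath x r) → y ∈ tverts t →
    y ≡ x ⊎ (indeg G y ≡ 1 × ∃ λ p → p ∈ tverts t × E G p y)
  ∈tverts⇒predecessor ε (here refl) = inj₁ refl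
  ∈tverts⇒predecessor (_ ◅ _) (here refl) = inj₁ refl
  ∈tverts⇒predecessor (_ ◅ t) (there y∈) with ∈tverts⇒predecessor t y∈
  ∈tverts⇒predecessor ((e , d) ◅ t) (there y∈) | inj₁ refl = inj₂ (d , _ , here refl , e)
  ... | inj₂ (d , p , p∈ , e) = inj₂ (d , p , there p∈ , e)

  -- Tree paths only merge at their starts, since inner vertices have a unique parent.
  treePaths-meet : (t : TreePath a x) (t′ : TreePath b x) → a ∈ tverts t′ ⊎ b ∈ tverts t
  treePaths-meet ε t′ = inj₁ (end∈tverts t′)
  treePaths-meet ((e , d) ◅ t) t′ with treePaths-meet t t′
  ... | inj₂ b∈ = inj₂ (there b∈)
  ... | inj₁ c∈ with ∈tverts⇒predecessor t′ c∈
  ...   | inj₁ refl = inj₂ (there (start∈tverts t))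
  ...   | inj₂ (_ , _ , p∈ , e′) with indeg≡1⇒parent-unique d e′ e
  ...     | refl = inj₁ p∈

  sourceChild∉treePath : indeg G s ≡ 0 → E G s c → E G s c′ → indeg G c′ ≡ 1 → c′ ≢ c →
    (t : TreePath c r) → ¬ c′ ∈ tverts t
  sourceChild∉treePath d₀ e e′ d′ c′≢c t c′∈ with ∈tverts⇒predecessor t c′∈
  ... | inj₁ c′≡c = c′≢c c′≡c
  ... | inj₂ (_ , p , p∈ , e″) with indeg≡1⇒parent-unique d′ e″ e′
  ...   | refl with ∈tverts⇒predecessor t p∈
  ...     | inj₁ refl = indeg≡0⇒¬edge d₀ e
  ...     | inj₂ (d , _) = 0≢1+n (trans (sym d₀) d)

  open DecMembership (_≟_ {size}) using (_∈?_)

  -- The summand of gamma, so that gamma D w is definitionally a sum of visit w over tree edges.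
  visit : V G → Walk G u v → ℕ
  visit {u} w q = b2n (does (w ∈? verts G q) ∧ not (does (w ≟ u)))

  module Acyclic-properties (acyc : Acyclic G) where

    start∉after : (q : Walk G u v) → ¬ u ∈ after G q
    start∉after q u∈ = acyc _ (∈after⇒walk q u∈)

    verts-distinct : (q : Walk G u v) → AllPairs _≢_ (u ∷ afterVec q)
    verts-distinct q = All-map (λ { w refl → acyc _ w }) (prefixes q) ∷ rest q
      where
      rest : (q : Walk G u v) → AllPairs _≢_ (afterVec q)
      rest (one _) = [] ∷ []
      rest (step _ q) = verts-distinct q

    length<size : (q : Walk G u v) → length q < size
    length<size {u} q = injective⇒≤ {f = lookup (u ∷ afterVec q)} (lookup-injective (verts-distinct q) _ _)

    -- Induction on a fuel bound: every walk has fewer than size edges.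
    children-rec : (P : V G → Set) → (∀ v → (∀ c → E G v c → P c) → P v) → ∀ v → P v
    children-rec P step-P v = go size v length<size
      where
      go : ∀ n v → (∀ {x} (q : Walk G v x) → length q < n) → P v
      go zero v bound = step-P v λ c e → ⊥-elim (n≮0 (bound (one e)))
      go (suc n) v bound = step-P v λ c e → go n c λ q → ≤-pred (bound (step e q))

    parents-rec : (P : V G → Set) → (∀ v → (∀ y → E G y v → P y) → P v) → ∀ v → P v
    parents-rec P step-P v = go size v length<size
      where
      go : ∀ n v → (∀ {x} (q : Walk G x v) → length q < n) → P v
      go zero v bound = step-P v λ y e → ⊥-elim (n≮0 (bound (one e)))
      go (suc n) v bound = step-P v λ y e → go n y λ q →
        ≤-pred (subst (_< suc n) (length-▷ q e) (bound (q ▷ e)))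

    visit≡1 : (q : Walk G u v) → w ∈ after G q → visit w q ≡ 1
    visit≡1 {u} {w = w} q w∈ with w ≟ u
    ... | yes refl = ⊥-elim (start∉after q w∈)
    ... | no _ with w ∈? after G q
    ...   | yes _ = refl
    ...   | no w∉ = ⊥-elim (w∉ w∈)

    visit≡0 : (q : Walk G u v) → ¬ w ∈ after G q → visit w q ≡ 0
    visit≡0 {u} {w = w} q w∉ with w ≟ u
    ... | yes refl = refl
    ... | no _ with w ∈? after G q
    ...   | yes w∈ = ⊥-elim (w∉ w∈)
    ...   | no _ = refl

    1≤visit⇒∈after : (q : Walk G u v) → 1 ≤ visit w q → w ∈ after G q
    1≤visit⇒∈after {w = w} q h = decide (w ∈? after G q)
      where
      decide : Dec (w ∈ after G q) → w ∈ after G q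
      decide (yes w∈) = w∈
      decide (no w∉) = ⊥-elim (1+n≰n (subst (1 ≤_) (visit≡0 q w∉) h))

    -- A walk through w, whose only parent is p, reaches w either from p inside the walk
    -- or directly from its start p; and if w lies on the walk the walk cannot end at p.
    visit-child≤visit-parent : E G p w → indeg G w ≡ 1 → (q : Walk G a b) →
      visit w q + χ (b ≟ p) ≤ visit p q + χ (a ≟ p ×-dec second G q ≟ w)
    visit-child≤visit-parent {p} {w} {a} {b} e d q = by-cases (w ∈? after G q)
      where
      open ≤-Reasoning

      end≢p : w ∈ after G q → b ≢ p
      end≢p w∈ refl with ∈verts⇒walk-to-end q (there w∈)
      ... | inj₁ refl = acyc _ (one e)
      ... | inj₂ w⇝b = acyc _ (w⇝b ▷ e)

      parent-counted : w ∈ after G q → 1 ≤ visit p q + χ (a ≟ p ×-dec second G q ≟ w)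
      parent-counted w∈ with ∈after⇒predecessor q w∈
      ... | inj₁ w≡second = begin
        1 ≡⟨ sym (χ-yes (a ≟ p ×-dec second G q ≟ w) (a≡p , sym w≡second)) ⟩
        χ (a ≟ p ×-dec second G q ≟ w) ≤⟨ m≤n+m _ _ ⟩
        visit p q + χ (a ≟ p ×-dec second G q ≟ w) ∎
        where a≡p = indeg≡1⇒parent-unique d (subst (E G a) (sym w≡second) (first-edge q)) e
      ... | inj₂ (y , y∈ , e′) = begin
        1 ≡⟨ sym (visit≡1 q (subst (_∈ after G q) (indeg≡1⇒parent-unique d e′ e) y∈)) ⟩
        visit p q ≤⟨ m≤m+n _ _ ⟩
        visit p q + χ (a ≟ p ×-dec second G q ≟ w) ∎

      by-cases : Dec (w ∈ after G q) →
        visit w q + χ (b ≟ p) ≤ visit p q + χ (a ≟ p ×-dec second G q ≟ w)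
      by-cases (yes w∈) = begin
        visit w q + χ (b ≟ p) ≡⟨ cong₂ _+_ (visit≡1 q w∈) (χ-no (b ≟ p) (end≢p w∈)) ⟩
        1 ≤⟨ parent-counted w∈ ⟩
        visit p q + χ (a ≟ p ×-dec second G q ≟ w) ∎
      by-cases (no w∉) = begin
        visit w q + χ (b ≟ p) ≡⟨ cong (_+ χ (b ≟ p)) (visit≡0 q w∉) ⟩
        χ (b ≟ p) ≤⟨ end-counted (b ≟ p) ⟩
        visit p q ≤⟨ m≤m+n _ _ ⟩
        visit p q + χ (a ≟ p ×-dec second G q ≟ w) ∎
        where
        end-counted : (b≟p : Dec (b ≡ p)) → χ b≟p ≤ visit p q
        end-counted (no _) = z≤n
        end-counted (yes refl) = ≤-reflexive (sym (visit≡1 q (end∈after q)))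

module Network {m} (N : PhyloNetwork m) where
  GN : Digraph
  GN = graph N

  ρ : V GN
  ρ = root N

  open Digraphs GN public
  open Acyclic-properties (acyclic N) public

  private variable
    a b v y : V GN

  root-indeg≡0 : indeg GN ρ ≡ 0
  root-indeg≡0 = proj₁ (root-deg N)

  root-indeg≢1 : indeg GN ρ ≢ 1
  root-indeg≢1 d = 0≢1+n (trans (sym root-indeg≡0) d)

  ¬edge-to-root : ¬ E GN y ρ
  ¬edge-to-root = indeg≡0⇒¬edge root-indeg≡0

  root∉after : (q : Walk GN a b) → ¬ ρ ∈ after GN q
  root∉after q ρ∈ = ¬edge-to-root (proj₂ (∈after⇒parent q ρ∈))

  visit-root≡0 : (q : Walk GN a b) → visit ρ q ≡ 0
  visit-root≡0 q = visit≡0 q (root∉after q)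

  nonroot⇒indeg≡1⊎reticulation : v ≢ ρ → indeg GN v ≡ 1 ⊎ IsReticulation GN v
  nonroot⇒indeg≡1⊎reticulation v≢ρ with other-deg N _ v≢ρ
  ... | inj₁ (d , _) = inj₁ d
  ... | inj₂ (inj₁ v-ret) = inj₂ v-ret
  ... | inj₂ (inj₂ (d , _)) = inj₁ d

  nonroot⇒parent : v ≢ ρ → ∃ λ y → E GN y v
  nonroot⇒parent v≢ρ with nonroot⇒indeg≡1⊎reticulation v≢ρ
  ... | inj₁ d = 1≤indeg⇒parent (≤-reflexive (sym d))
  ... | inj₂ (d , _) = 1≤indeg⇒parent (subst (1 ≤_) (sym d) (s≤s z≤n))

  leaf≢root : IsLeaf GN v → v ≢ ρ
  leaf≢root (d , _) refl = root-indeg≢1 d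

module Display {m} {N : PhyloNetwork m} {Tr : PhyloTree m} (D : DisplayMap Tr N) where
  open Network N
  private
    module T = Network (net Tr)

    GT : Digraph
    GT = graph (net Tr)

    rT : V GT
    rT = root (net Tr)

  private variable
    c p w x : V GN
    u : V GT

  edgeSum : (∀ u v → E GT u v → ℕ) → ℕ
  edgeSum F = sumF λ u → sumF λ v → indic (Digraph.edge GT u v) (F u v)

  edgeSum-+ : ∀ F H → edgeSum (λ u v e → F u v e + H u v e) ≡ edgeSum F + edgeSum H
  edgeSum-+ F H = trans
    (sumF-cong λ u → trans (sumF-cong λ v → indic-+ (Digraph.edge GT u v) (F u v) (H u v))
                           (sumF-+ (term F u) (term H u)))
    (sumF-+ (λ u → sumF (term F u)) (λ u → sumF (term H u)))
    where
    term : (∀ u v → E GT u v → ℕ) → V GT → V GT → ℕ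
    term F u v = indic (Digraph.edge GT u v) (F u v)

  edgeSum-mono : ∀ {F H} → (∀ u v e → F u v e ≤ H u v e) → edgeSum F ≤ edgeSum H
  edgeSum-mono F≤H = sumF-mono λ u → sumF-mono λ v → indic-mono _ (F≤H u v)

  summand≤edgeSum : ∀ F u v (e : E GT u v) → F u v e ≤ edgeSum F
  summand≤edgeSum F u v e = begin
    F u v e                                              ≡⟨ sym (indic-at (F u v) e) ⟩
    indic (Digraph.edge GT u v) (F u v)                  ≤⟨ term≤sumF _ v ⟩
    sumF (λ v → indic (Digraph.edge GT u v) (F u v))     ≤⟨ term≤sumF _ u ⟩
    edgeSum F                                            ∎
    where open ≤-Reasoning

  γ : V GN → ℕ
  γ = gamma D

  ∈path⇒1≤γ : ∀ u v (e : E GT u v) → w ∈ after GN (path D u v e) → 1 ≤ γ w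
  ∈path⇒1≤γ {w} u v e w∈ = subst (_≤ γ w) (visit≡1 (path D u v e) w∈)
    (summand≤edgeSum (λ u v e → visit w (path D u v e)) u v e)

  1≤γ⇒∈path : 1 ≤ γ w → ∃₂ λ u v → Σ (E GT u v) λ e → w ∈ after GN (path D u v e)
  1≤γ⇒∈path h =
    let u , h₁ = 1≤sumF⇒∃ _ h
        v , h₂ = 1≤sumF⇒∃ _ h₁
        e , h₃ = 1≤indic⇒ _ _ h₂
    in u , v , e , 1≤visit⇒∈after _ h₃

  γ-root≡0 : γ ρ ≡ 0
  γ-root≡0 = sumF-zero λ u → sumF-zero λ v →
    n≤0⇒n≡0 (indic≤ _ λ e → ≤-reflexive (visit-root≡0 (path D u v e)))

  image≡root⇒root : ψ D u ≡ ρ → u ≡ rT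
  image≡root⇒root {u} ψu≡ρ with u ≟ rT
  ... | yes u≡rT = u≡rT
  ... | no u≢rT =
    let u′ , e = T.nonroot⇒parent u≢rT
        y , e′ = last-edge (path D u′ u e)
    in ⊥-elim (¬edge-to-root (subst (E GN y) ψu≡ρ e′))

  preimages : V GN → ℕ
  preimages p = sumF λ u → χ (ψ D u ≟ p)

  endingAt : V GN → ℕ
  endingAt p = edgeSum λ u v _ → χ (ψ D v ≟ p)

  leaving : V GN → V GN → ℕ
  leaving p w = edgeSum λ u v e → χ (ψ D u ≟ p ×-dec second GN (path D u v e) ≟ w)

  γ-child+endingAt≤γ-parent+leaving : E GN p w → indeg GN w ≡ 1 →
    γ w + endingAt p ≤ γ p + leaving p w
  γ-child+endingAt≤γ-parent+leaving {p} {w} e d = begin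
    γ w + endingAt p   ≡⟨ sym (edgeSum-+ _ _) ⟩
    edgeSum _          ≤⟨ edgeSum-mono (λ u v e′ → visit-child≤visit-parent e d (path D u v e′)) ⟩
    edgeSum _          ≡⟨ edgeSum-+ _ _ ⟩
    γ p + leaving p w  ∎
    where open ≤-Reasoning

  leaving≤preimages : leaving p w ≤ preimages p
  leaving≤preimages {p} {w} = sumF-mono row
    where
    leavesTowards : ∀ u v → ℕ
    leavesTowards u v = indic (Digraph.edge GT u v) λ e → χ (second GN (path D u v e) ≟ w)

    atMostOne : ∀ u v v′ → 1 ≤ leavesTowards u v → 1 ≤ leavesTowards u v′ → v ≡ v′
    atMostOne u v v′ h h′ with v ≟ v′
    ... | yes v≡v′ = v≡v′
    ... | no v≢v′ =
      let e , s≡w = 1≤indic⇒ (Digraph.edge GT u v) _ h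
          e′ , s′≡w = 1≤indic⇒ (Digraph.edge GT u v′) _ h′
      in ⊥-elim (first-distinct D u v v′ e e′ v≢v′
                   (trans (1≤χ⇒ (_ ≟ w) s≡w) (sym (1≤χ⇒ (_ ≟ w) s′≡w))))

    row : ∀ u → sumF (λ v → indic (Digraph.edge GT u v) λ e →
                  χ (ψ D u ≟ p ×-dec second GN (path D u v e) ≟ w))
                ≤ χ (ψ D u ≟ p)
    row u with ψ D u ≟ p
    ... | no _ = ≤-reflexive (sumF-zero λ v → n≤0⇒n≡0 (indic≤ (Digraph.edge GT u v) λ _ → z≤n))
    ... | yes _ = sumF≤1 (leavesTowards u) (λ v → indic≤ (Digraph.edge GT u v) λ _ → b2n≤1 _)
                    (atMostOne u)

  -- Every vertex of the tree except its root is the head of a tree edge.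
  preimages≤endingAt : p ≢ ψ D rT → preimages p ≤ endingAt p
  preimages≤endingAt {p} p≢ψrT = begin
    preimages p                        ≤⟨ sumF-mono column ⟩
    sumF (λ v → sumF λ u → ends u v)   ≡⟨ sym (sumF-swap ends) ⟩
    endingAt p                         ∎
    where
    open ≤-Reasoning
    ends : V GT → V GT → ℕ
    ends u v = indic (Digraph.edge GT u v) λ _ → χ (ψ D v ≟ p)

    column : ∀ v → χ (ψ D v ≟ p) ≤ sumF λ u → ends u v
    column v with ψ D v ≟ p
    ... | no _ = z≤n
    ... | yes ψv≡p with v ≟ rT
    ...   | yes refl = ⊥-elim (p≢ψrT (sym ψv≡p))
    ...   | no v≢rT = let u , e = T.nonroot⇒parent v≢rT in
                      ≤-trans (≤-reflexive (sym (indic-at _ e))) (term≤sumF _ u)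

  preimages-root≤1 : preimages ρ ≤ 1
  preimages-root≤1 = sumF≤1 _ (λ _ → b2n≤1 _) λ u u′ h h′ →
    trans (image≡root⇒root (1≤χ⇒ (ψ D u ≟ ρ) h)) (sym (image≡root⇒root (1≤χ⇒ (ψ D u′ ≟ ρ) h′)))

  γ-child≤γ-parent : E GN p w → indeg GN w ≡ 1 → p ≢ ψ D rT → γ w ≤ γ p
  γ-child≤γ-parent {p} {w} e d p≢ψrT = +-cancelʳ-≤ (endingAt p) (γ w) (γ p) (begin
    γ w + endingAt p    ≤⟨ γ-child+endingAt≤γ-parent+leaving e d ⟩
    γ p + leaving p w   ≤⟨ +-monoʳ-≤ (γ p) (≤-trans leaving≤preimages (preimages≤endingAt p≢ψrT)) ⟩
    γ p + endingAt p    ∎)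
    where open ≤-Reasoning

  γ-rootChild≤1 : E GN ρ w → indeg GN w ≡ 1 → γ w ≤ 1
  γ-rootChild≤1 {w} e d = begin
    γ w                 ≤⟨ m≤m+n (γ w) (endingAt ρ) ⟩
    γ w + endingAt ρ    ≤⟨ γ-child+endingAt≤γ-parent+leaving e d ⟩
    γ ρ + leaving ρ w   ≡⟨ cong (_+ leaving ρ w) γ-root≡0 ⟩
    leaving ρ w         ≤⟨ leaving≤preimages ⟩
    preimages ρ         ≤⟨ preimages-root≤1 ⟩
    1                   ∎
    where open ≤-Reasoning

  image-visited : u ≢ rT → 1 ≤ γ (ψ D u)
  image-visited {u} u≢rT = let u′ , e = T.nonroot⇒parent u≢rT in
    ∈path⇒1≤γ u′ u e (end∈after (path D u′ u e))

  leaf-visited : IsLeaf GN x → 1 ≤ γ x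
  leaf-visited x-leaf =
    let i , leafᵢ≡x = leaf-onto N _ x-leaf
        ψ-leafᵢ≡x = trans (id-on-X D i) leafᵢ≡x
    in subst (λ x → 1 ≤ γ x) ψ-leafᵢ≡x
         (image-visited (T.leaf≢root (leaf-isLeaf (net Tr) i)))

  visited-child⇒visited-parent : E GN x w → indeg GN w ≡ 1 → 1 ≤ γ w → 1 ≤ γ x ⊎ x ≡ ψ D rT
  visited-child⇒visited-parent {x} e d h with 1≤γ⇒∈path h
  ... | u , v , e′ , w∈ with ∈after⇒predecessor (path D u v e′) w∈
  ...   | inj₂ (y , y∈ , e″) rewrite indeg≡1⇒parent-unique d e″ e = inj₁ (∈path⇒1≤γ u v e′ y∈)
  ...   | inj₁ refl with indeg≡1⇒parent-unique d (first-edge (path D u v e′)) e | u ≟ rT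
  ...     | refl | yes refl = inj₂ refl
  ...     | refl | no u≢rT = inj₁ (image-visited u≢rT)

  visited⊎treePath-to-rootImage : IsTreeChild N → ∀ x → 1 ≤ γ x ⊎ TreePath x (ψ D rT)
  visited⊎treePath-to-rootImage treeChild = children-rec _ grow
    where
    grow : ∀ x → (∀ c → E GN x c → 1 ≤ γ c ⊎ TreePath c (ψ D rT)) → 1 ≤ γ x ⊎ TreePath x (ψ D rT)
    grow x IH with (indeg GN x ℕ.≟ 1) ×-dec (outdeg GN x ℕ.≟ 0)
    ... | yes x-leaf = inj₁ (leaf-visited x-leaf)
    ... | no x-inner with treeChild x x-inner
    ...   | c , e , (d , _) with IH c e
    ...     | inj₂ t = inj₂ ((e , d) ◅ t)
    ...     | inj₁ h with visited-child⇒visited-parent e d h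
    ...       | inj₁ h′ = inj₁ h′
    ...       | inj₂ refl = inj₂ ε

  rootChild⇒rootImage≡root⊎treePath : IsTreeChild N → E GN ρ c → indeg GN c ≡ 1 →
    ψ D rT ≡ ρ ⊎ TreePath c (ψ D rT)
  rootChild⇒rootImage≡root⊎treePath {c} treeChild e d with visited⊎treePath-to-rootImage treeChild c
  ... | inj₂ t = inj₂ t
  ... | inj₁ h with visited-child⇒visited-parent e d h
  ...   | inj₁ h′ = ⊥-elim (1+n≰n (subst (1 ≤_) γ-root≡0 h′))
  ...   | inj₂ ρ≡ψrT = inj₁ (sym ρ≡ψrT)

  rootImage≡root : IsTreeChild N → (∀ {c} → E GN ρ c → indeg GN c ≡ 1) → ψ D rT ≡ ρ
  rootImage≡root treeChild rootChild with outdeg≡2⇒children (proj₂ (root-deg N))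
  ... | c , c′ , c≢c′ , e , e′
    with rootChild⇒rootImage≡root⊎treePath treeChild e (rootChild e)
       | rootChild⇒rootImage≡root⊎treePath treeChild e′ (rootChild e′)
  ... | inj₁ ψrT≡ρ | _ = ψrT≡ρ
  ... | inj₂ _ | inj₁ ψrT≡ρ = ψrT≡ρ
  ... | inj₂ t | inj₂ t′ with treePaths-meet t t′
  ...   | inj₁ c∈ = ⊥-elim (sourceChild∉treePath root-indeg≡0 e′ e (rootChild e) c≢c′ t′ c∈)
  ...   | inj₂ c′∈ = ⊥-elim (sourceChild∉treePath root-indeg≡0 e e′ (rootChild e′) (c≢c′ ∘ sym) t c′∈)

  nonroot-visited : IsTreeChild N → ψ D rT ≡ ρ → x ≢ ρ → 1 ≤ γ x
  nonroot-visited {x} treeChild ψrT≡ρ x≢ρ with visited⊎treePath-to-rootImage treeChild x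
  ... | inj₁ h = h
  ... | inj₂ t with ∈tverts⇒predecessor t (end∈tverts t)
  ...   | inj₁ ψrT≡x = ⊥-elim (x≢ρ (trans (sym ψrT≡x) ψrT≡ρ))
  ...   | inj₂ (d , _) = ⊥-elim (root-indeg≢1 (subst (λ z → indeg GN z ≡ 1) ψrT≡ρ d))

module Temporal {m} (N : PhyloNetwork m) (temporal : IsTemporal N) where
  open Network N
  private
    t : V GN → ℚ
    t = proj₁ temporal

    t-edge : ∀ p q → E GN p q →
      (IsReticulation GN q → t p ≡ t q) × (¬ IsReticulation GN q → t p <ℚ t q)
    t-edge = proj₂ (proj₂ temporal)

  private variable
    c q : V GN

  isReticulation? : ∀ x → Dec (IsReticulation GN x)
  isReticulation? x = (indeg GN x ℕ.≟ 2) ×-dec (outdeg GN x ℕ.≟ 1)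

  root-earliest : ∀ v → t ρ ≤ℚ t v × (v ≢ ρ → ¬ IsReticulation GN v → t ρ <ℚ t v)
  root-earliest = parents-rec _ go
    where
    go : ∀ v → (∀ y → E GN y v → t ρ ≤ℚ t y × (y ≢ ρ → ¬ IsReticulation GN y → t ρ <ℚ t y)) →
         t ρ ≤ℚ t v × (v ≢ ρ → ¬ IsReticulation GN v → t ρ <ℚ t v)
    go v IH with v ≟ ρ
    ... | yes refl = ℚ.≤-refl , λ ρ≢ρ → ⊥-elim (ρ≢ρ refl)
    ... | no v≢ρ with nonroot⇒parent v≢ρ
    ...   | y , e with isReticulation? v
    ...     | yes v-ret = subst (t ρ ≤ℚ_) (proj₁ (t-edge y v e) v-ret) (proj₁ (IH y e)) ,
                          λ _ ¬v-ret → ⊥-elim (¬v-ret v-ret)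
    ...     | no ¬v-ret = ℚ.<⇒≤ ρ<v , λ _ _ → ρ<v
      where ρ<v = ℚ.≤-<-trans (proj₁ (IH y e)) (proj₂ (t-edge y v e) ¬v-ret)

  -- Both parents of a reticulation child of the root share the root's time; a tree vertex
  -- cannot, and a reticulation parent would have no tree child.
  rootChild-reticulation⇒parent≡root : IsTreeChild N → E GN ρ c → IsReticulation GN c →
    E GN q c → q ≡ ρ
  rootChild-reticulation⇒parent≡root {c} {q} treeChild e c-ret e′ with q ≟ ρ
  ... | yes q≡ρ = q≡ρ
  ... | no q≢ρ with isReticulation? q
  ...   | no ¬q-ret = ⊥-elim (ℚ.<-irrefl t-ρ≡t-q (proj₂ (root-earliest q) q≢ρ ¬q-ret))
    where t-ρ≡t-q = trans (proj₁ (t-edge ρ c e) c-ret) (sym (proj₁ (t-edge q c e′) c-ret))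
  ...   | yes (_ , q-out≡1) with treeChild q (λ q-leaf → 0≢1+n (trans (sym (proj₂ q-leaf)) q-out≡1))
  ...     | c′ , e″ , (c′-in≡1 , _) with outdeg≡1⇒child-unique q-out≡1 e″ e′
  ...       | refl with () ← trans (sym (proj₁ c-ret)) c′-in≡1

  rootChild-indeg≡1 : IsTreeChild N → E GN ρ c → indeg GN c ≡ 1
  rootChild-indeg≡1 {c} treeChild e with c ≟ ρ
  ... | yes refl = ⊥-elim (¬edge-to-root e)
  ... | no c≢ρ with nonroot⇒indeg≡1⊎reticulation c≢ρ
  ...   | inj₁ d = d
  ...   | inj₂ c-ret =
    let a , b , a≢b , ea , eb = indeg≡2⇒parents (proj₁ c-ret)
    in ⊥-elim (a≢b (trans (rootChild-reticulation⇒parent≡root treeChild e c-ret ea)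
                     (sym (rootChild-reticulation⇒parent≡root treeChild e c-ret eb))))

γ-sum≤3 : ∀ {m} {N : PhyloNetwork m} {Tr Tr′ : PhyloTree m}
  (D : DisplayMap Tr N) (D′ : DisplayMap Tr′ N) →
  ψ D (root (net Tr)) ≡ root N → ψ D′ (root (net Tr′)) ≡ root N →
  (∀ v → IsReticulation (graph N) v → gamma D v + gamma D′ v ≤ 3) →
  ∀ v → v ≢ root N → gamma D v + gamma D′ v ≤ 3
γ-sum≤3 {N = N} D D′ ψrT≡ρ ψ′rT′≡ρ reticulation≤3 = parents-rec _ bound
  where
  open Network N
  module Δ = Display D
  module Δ′ = Display D′

  Bounded : V GN → Set
  Bounded v = v ≢ ρ → Δ.γ v + Δ′.γ v ≤ 3

  bound : ∀ v → (∀ p → E GN p v → Bounded p) → Bounded v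
  bound v IH v≢ρ with nonroot⇒indeg≡1⊎reticulation v≢ρ | nonroot⇒parent v≢ρ
  ... | inj₂ v-ret | _ = reticulation≤3 v v-ret
  ... | inj₁ d | p , e with p ≟ ρ
  ...   | yes refl = ≤-trans (+-mono-≤ (Δ.γ-rootChild≤1 e d) (Δ′.γ-rootChild≤1 e d)) (n≤1+n 2)
  ...   | no p≢ρ = ≤-trans (+-mono-≤ (Δ.γ-child≤γ-parent e d λ p≡ψrT → p≢ρ (trans p≡ψrT ψrT≡ρ))
                                      (Δ′.γ-child≤γ-parent e d λ p≡ψ′rT′ → p≢ρ (trans p≡ψ′rT′ ψ′rT′≡ρ)))
                           (IH p e p≢ρ)

lemma4 : ∀ {m} → 2 ≤ m → (N : PhyloNetwork m) → IsTemporal N → IsTreeChild N →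
    (Tr Tr' : PhyloTree m) (D : DisplayMap Tr N) (D' : DisplayMap Tr' N) →
    RigidlyDisplays N D D' →
    ∀ v → v ≢ root N → 2 ≤ gamma D v + gamma D' v × gamma D v + gamma D' v ≤ 3
lemma4 _ N temporal treeChild Tr Tr' D D' (reticulation≤3 , _) v v≢ρ =
  +-mono-≤ (Δ.nonroot-visited treeChild ψrT≡ρ v≢ρ) (Δ′.nonroot-visited treeChild ψ′rT′≡ρ v≢ρ) ,
  γ-sum≤3 D D' ψrT≡ρ ψ′rT′≡ρ reticulation≤3 v v≢ρ
  where
  module Δ = Display D
  module Δ′ = Display D'
  rootChild-indeg≡1 : ∀ {c} → E (graph N) (root N) c → indeg (graph N) c ≡ 1
  rootChild-indeg≡1 = Temporal.rootChild-indeg≡1 N temporal treeChild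

  ψrT≡ρ : ψ D (root (net Tr)) ≡ root N
  ψrT≡ρ = Δ.rootImage≡root treeChild rootChild-indeg≡1

  ψ′rT′≡ρ : ψ D' (root (net Tr')) ≡ root N
  ψ′rT′≡ρ = Δ′.rootImage≡root treeChild rootChild-indeg≡1
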